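{- Let $v=v_1\cdots v_n$ be a word of distinct positive integers avoiding $31425,32415,31524,32514$. Let the left-to-right maxima of $v$ be at positions $a_1<\dots<a_h$ and the right-to-left maxima at positions $b_1<\dots<b_g$, so $1=a_1$, $a_h=b_1$, $b_g=n$. Suppose $g>1$, $a_h>h$, $h>2$ and $v_{a_{h-1}}>v_{b_2}$. Let $x=\max(\{j: j<a_{h-1},\ v_j>v_{j+1}\}\cup\{0\})$. Then one of the following holds: (B-1) $x=0$; (B-2) $x\neq0$ and $a_h=a_{h-1}+1$; moreover, if $v_{b_2}>v_x$ then $v_{b_2}>v_j>v_x$ for all $a_h<j<b_2$; (B-3) $x\neq0$, $a_h>a_{h-1}+1$ and $v_{a_{h-1}}>v_j>v_x$ for all $a_{h-1}<j<a_h$; moreover, if $v_{b_2}>v_x$ then $v_{b_2}>v_j>v_x$ for all $a_h<j<b_2$.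
   Context: A word avoids a pattern $P$ if it has no subsequence order-isomorphic to $P$. A left-to-right (resp. right-to-left) maximum of $v$ is an entry larger than all entries to its left (resp. right). -}

module Defs where

open import Data.Nat using (ℕ; zero; suc; _<_; _≤_; _<ᵇ_; _∸_; _⊔_)
open import Data.Nat.Properties using ()
open import Data.Bool using (Bool; true; false)
open import Data.List using (List; []; _∷_; map; upTo; filter; length; foldr)
open import Data.Vec using (Vec; lookup; []; _∷_)
open import Data.Fin as F using (Fin)
open import Data.Product using (Σ; _×_)
open import Function.Bundles using (_⇔_)
open import Relation.Binary.PropositionalEquality using (_≡_)
open import Relation.Nullary using (¬_)
open import Data.Bool using (T; _∧_)
open import Relation.Nullary.Decidable using (does)

-- A word of length n is v : ℕ → ℕ, whose letters are v 1, ..., v n (1-indexed);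
-- values of v outside positions 1..n are irrelevant.

range : ℕ → List ℕ
range n = map suc (upTo n)

DistinctPositive : (n : ℕ) → (ℕ → ℕ) → Set
DistinctPositive n v =
  (∀ i → 1 ≤ i → i ≤ n → 1 ≤ v i) ×
  (∀ i j → 1 ≤ i → i ≤ n → 1 ≤ j → j ≤ n → v i ≡ v j → i ≡ j)

Occurrence : {k : ℕ} → Vec ℕ k → (n : ℕ) → (ℕ → ℕ) → Set
Occurrence {k} P n v =
  Σ (Fin k → ℕ) λ f →
    (∀ p q → p F.< q → f p < f q) ×
    (∀ p → 1 ≤ f p × f p ≤ n) ×
    (∀ p q → (v (f p) < v (f q)) ⇔ (lookup P p < lookup P q))

Avoids : {k : ℕ} → Vec ℕ k → (n : ℕ) → (ℕ → ℕ) → Set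
Avoids P n v = ¬ Occurrence P n v

p31425 p32415 p31524 p32514 : Vec ℕ 5
p31425 = 3 ∷ 1 ∷ 4 ∷ 2 ∷ 5 ∷ []
p32415 = 3 ∷ 2 ∷ 4 ∷ 1 ∷ 5 ∷ []
p31524 = 3 ∷ 1 ∷ 5 ∷ 2 ∷ 4 ∷ []
p32514 = 3 ∷ 2 ∷ 5 ∷ 1 ∷ 4 ∷ []

allB : (ℕ → Bool) → List ℕ → Bool
allB p [] = true
allB p (x ∷ xs) = p x ∧ allB p xs

isLRmax : (ℕ → ℕ) → ℕ → Bool
isLRmax v i = allB (λ j → v j <ᵇ v i) (range (i ∸ 1))

isRLmax : ℕ → (ℕ → ℕ) → ℕ → Bool
isRLmax n v i = allB (λ j → v j <ᵇ v i) (map (λ t → i + t) (range (n ∸ i)))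
  where open import Data.Nat using (_+_)

lrMaxPositions : ℕ → (ℕ → ℕ) → List ℕ
lrMaxPositions n v = filter (λ i → T? (isLRmax v i)) (range n)
  where open import Data.Bool.Properties using () renaming (T? to T?)

rlMaxPositions : ℕ → (ℕ → ℕ) → List ℕ
rlMaxPositions n v = filter (λ i → T? (isRLmax n v i)) (range n)
  where open import Data.Bool.Properties using () renaming (T? to T?)

-- 1-indexed list access (default 0 when out of range; only used in range)
nth : List ℕ → ℕ → ℕ
nth [] _ = 0
nth (x ∷ xs) zero = 0
nth (x ∷ xs) (suc zero) = x
nth (x ∷ xs) (suc (suc k)) = nth xs (suc k)

lastDescentBefore : (ℕ → ℕ) → ℕ → ℕ
lastDescentBefore v a =
  foldr _⊔_ 0 (filter (λ j → T? (v (suc j) <ᵇ v j)) (range (a ∸ 1)))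
  where open import Data.Bool.Properties using () renaming (T? to T?)

{-# OPTIONS --safe #-}
module Submission where

-- Let a = a_{h-1} and A = a_h, and let x be the last descent before a. Letters strictly between
-- two consecutive left-to-right maxima lie below the first of them, letters after A lie below v_A (so A
-- is also a right-to-left maximum and b_1 ≤ A), and letters strictly between b_1 and b_2 lie below
-- v_{b_2}. A letter v_j < v_x with a < j < A, or with A < j < b_2 and v_x < v_{b_2}, would complete
-- x, x+1 and the maxima around j to one of the four avoided patterns.

open import Defs
open import Data.Nat using (ℕ; zero; suc; _<_; _≤_; _∸_; _+_; _<ᵇ_; _⊔_; z≤n; s≤s; z<s; s<s; s<s⁻¹)
open import Data.Nat.Properties
open import Data.Nat.Induction using (<-wellFounded)
open import Induction.WellFounded using (Acc; acc)
open import Data.Bool using (Bool; true; false; T)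
open import Data.Bool.Properties using (T?; T-≡)
open import Data.List using (List; []; _∷_; length; map; filter; foldr; applyUpTo; upTo)
open import Data.List.Properties using (map-upTo; map-∘)
open import Data.Vec using (Vec; []; _∷_; lookup) renaming (map to mapᵛ)
open import Data.Vec.Properties using (lookup-map)
open import Data.Vec.Relation.Unary.Linked using (Linked; [-]; _∷_)
open import Data.Vec.Relation.Unary.Linked.Properties using (lookup⁺)
open import Data.Fin as F using (Fin; #_)
open import Data.Fin.Properties as Finₚ using (≤fromℕ; toℕ-injective)
open import Data.Product using (_×_; _,_; proj₁; proj₂; ∃-syntax)
open import Data.Sum using (_⊎_; inj₁; inj₂)
open import Data.Empty using (⊥; ⊥-elim)
open import Function using (_∘_; _⇔_; mk⇔; Equivalence)
open import Relation.Binary using (tri<; tri≈; tri>)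
open import Relation.Binary.PropositionalEquality
open import Relation.Nullary using (¬_)

interval : ℕ → ℕ → List ℕ
interval s zero = []
interval s (suc k) = s ∷ interval (suc s) k

InInterval : ℕ → ℕ → ℕ → Set
InInterval s k j = s ≤ j × j < s + k

InInterval-head : ∀ s k → InInterval s (suc k) s
InInterval-head s k = ≤-refl , m<m+n s z<s

InInterval-tail : ∀ {s k j} → InInterval (suc s) k j → InInterval s (suc k) j
InInterval-tail {s} {k} {j} (s<j , j<) = <⇒≤ s<j , subst (j <_) (sym (+-suc s k)) j<

InInterval-split : ∀ {s k j} → InInterval s (suc k) j → j ≡ s ⊎ InInterval (suc s) k j
InInterval-split {s} {k} {j} (s≤j , j<) with m≤n⇒m<n∨m≡n s≤j
... | inj₁ s<j = inj₂ (s<j , subst (j <_) (+-suc s k) j<)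
... | inj₂ refl = inj₁ refl

InInterval-empty : ∀ {s j} → ¬ InInterval s 0 j
InInterval-empty {s} {j} (s≤j , j<) = ≤⇒≯ s≤j (subst (j <_) (+-identityʳ s) j<)

applyUpTo-interval : ∀ (f : ℕ → ℕ) s k → (∀ t → f t ≡ s + t) → applyUpTo f k ≡ interval s k
applyUpTo-interval f s zero f≗ = refl
applyUpTo-interval f s (suc k) f≗ = cong₂ _∷_ (trans (f≗ 0) (+-identityʳ s))
  (applyUpTo-interval (f ∘ suc) (suc s) k (λ t → trans (f≗ (suc t)) (+-suc s t)))

range-interval : ∀ m → range m ≡ interval 1 m
range-interval m = trans (map-upTo suc m) (applyUpTo-interval suc 1 m (λ _ → refl))

map-+-range : ∀ i m → map (i +_) (range m) ≡ interval (suc i) m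
map-+-range i m = begin
  map (i +_) (map suc (upTo m))  ≡⟨ map-∘ (upTo m) ⟨
  map ((i +_) ∘ suc) (upTo m)    ≡⟨ map-upTo _ m ⟩
  applyUpTo ((i +_) ∘ suc) m     ≡⟨ applyUpTo-interval _ (suc i) m (+-suc i) ⟩
  interval (suc i) m             ∎
  where open ≡-Reasoning

allB-interval-true : ∀ p s k → allB p (interval s k) ≡ true → ∀ j → InInterval s k j → p j ≡ true
allB-interval-true p s zero _ j j∈ = ⊥-elim (InInterval-empty j∈)
allB-interval-true p s (suc k) all j j∈ with p s in ps | InInterval-split j∈
allB-interval-true p s (suc k) () j j∈ | false | _
... | true | inj₁ refl = ps
... | true | inj₂ j∈′ = allB-interval-true p (suc s) k all j j∈′

allB-interval-false : ∀ p s k → allB p (interval s k) ≡ false → ∃[ j ] InInterval s k j × p j ≡ false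
allB-interval-false p s zero ()
allB-interval-false p s (suc k) all with p s in ps
... | false = s , InInterval-head s k , ps
... | true with allB-interval-false p (suc s) k all
...   | j , j∈ , pj = j , InInterval-tail j∈ , pj

<ᵇ-true⇒< : ∀ {m n} → (m <ᵇ n) ≡ true → m < n
<ᵇ-true⇒< {m} {n} e = <ᵇ⇒< m n (Equivalence.from T-≡ e)

<ᵇ-false⇒≥ : ∀ {m n} → (m <ᵇ n) ≡ false → n ≤ m
<ᵇ-false⇒≥ e = ≮⇒≥ (λ m<n → subst T e (<⇒<ᵇ m<n))

last-≤-last-∷ : ∀ x xs → nth xs (length xs) ≤ nth (x ∷ xs) (length (x ∷ xs))
last-≤-last-∷ x [] = z≤n
last-≤-last-∷ x (y ∷ ys) = ≤-refl

last-∷-≥ : ∀ {s} xs → (∀ i → 1 ≤ i → i ≤ length xs → s ≤ nth xs i) →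
  s ≤ nth (s ∷ xs) (length (s ∷ xs))
last-∷-≥ [] _ = ≤-refl
last-∷-≥ (x ∷ xs) lower = lower (length (x ∷ xs)) (s≤s z≤n) ≤-refl

selected : (ℕ → Bool) → ℕ → ℕ → List ℕ
selected p s k = filter (λ i → T? (p i)) (interval s k)

selected-member : ∀ p s k i → 1 ≤ i → i ≤ length (selected p s k) →
  InInterval s k (nth (selected p s k) i) × p (nth (selected p s k) i) ≡ true
selected-member p s zero (suc i) _ ()
selected-member p s (suc k) i 1≤i i≤ with p s in ps
selected-member p s (suc k) i 1≤i i≤ | false with selected-member p (suc s) k i 1≤i i≤
... | x∈ , px = InInterval-tail x∈ , px
selected-member p s (suc k) 1 _ _ | true = InInterval-head s k , ps
selected-member p s (suc k) (suc (suc i)) _ (s≤s i≤) | true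
  with selected-member p (suc s) k (suc i) (s≤s z≤n) i≤
... | x∈ , px = InInterval-tail x∈ , px

selected-first : ∀ p s k j → s ≤ j → j < nth (selected p s k) 1 → p j ≡ false
selected-first p s zero j _ ()
selected-first p s (suc k) j s≤j j< with p s in ps
... | true = ⊥-elim (≤⇒≯ s≤j j<)
... | false with m≤n⇒m<n∨m≡n s≤j
...   | inj₂ refl = ps
...   | inj₁ s<j = selected-first p (suc s) k j s<j j<

selected-gap : ∀ p s k i → 2 ≤ i → i ≤ length (selected p s k) →
  let L = selected p s k in
  nth L (i ∸ 1) < nth L i × (∀ j → nth L (i ∸ 1) < j → j < nth L i → p j ≡ false)
selected-gap p s zero (suc i) _ ()
selected-gap p s (suc k) i 2≤i i≤ with p s in ps
selected-gap p s (suc k) i 2≤i i≤ | false = selected-gap p (suc s) k i 2≤i i≤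
selected-gap p s (suc k) 1 (s≤s ()) _ | true
selected-gap p s (suc k) 2 _ (s≤s 1≤) | true =
  proj₁ (proj₁ (selected-member p (suc s) k 1 ≤-refl 1≤)) , selected-first p (suc s) k
selected-gap p s (suc k) (suc (suc (suc i))) _ (s≤s i≤) | true =
  selected-gap p (suc s) k (suc (suc i)) (s≤s (s≤s z≤n)) i≤

selected-last : ∀ p s k j → s ≤ j → nth (selected p s k) (length (selected p s k)) < j → j < s + k →
  p j ≡ false
selected-last p s zero j s≤j _ j< = ⊥-elim (InInterval-empty (s≤j , j<))
selected-last p s (suc k) j s≤j last<j j< with p s in ps | InInterval-split (s≤j , j<)
... | false | inj₁ refl = ps
... | false | inj₂ (s<j , j<′) = selected-last p (suc s) k j s<j last<j j<′
... | true | inj₁ refl = ⊥-elim (≤⇒≯ (last-∷-≥ (selected p (suc s) k) above-s) last<j)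
  where
  above-s : ∀ i → 1 ≤ i → i ≤ length (selected p (suc s) k) → s ≤ nth (selected p (suc s) k) i
  above-s i 1≤i i≤ = <⇒≤ (proj₁ (proj₁ (selected-member p (suc s) k i 1≤i i≤)))
... | true | inj₂ (s<j , j<′) =
  selected-last p (suc s) k j s<j (≤-<-trans (last-≤-last-∷ s (selected p (suc s) k)) last<j) j<′

selected-max : ∀ p s k → let m = foldr _⊔_ 0 (selected p s k) in
  m ≡ 0 ⊎ (InInterval s k m × p m ≡ true)
selected-max p s zero = inj₁ refl
selected-max p s (suc k) with p s in ps
... | false with selected-max p (suc s) k
...   | inj₁ m≡0 = inj₁ m≡0
...   | inj₂ (m∈ , pm) = inj₂ (InInterval-tail m∈ , pm)
selected-max p s (suc k) | true with selected-max p (suc s) k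
... | inj₁ m≡0 rewrite m≡0 | ⊔-identityʳ s = inj₂ (InInterval-head s k , ps)
... | inj₂ (m∈ , pm) rewrite m≤n⇒m⊔n≡n (<⇒≤ (proj₁ m∈)) = inj₂ (InInterval-tail m∈ , pm)

isLRmax-true : ∀ v i → isLRmax v i ≡ true → ∀ k → 1 ≤ k → k < i → v k < v i
isLRmax-true v (suc i) lr k 1≤k k<i = <ᵇ-true⇒<
  (allB-interval-true (λ j → v j <ᵇ v (suc i)) 1 i
    (subst (λ xs → allB (λ j → v j <ᵇ v (suc i)) xs ≡ true) (range-interval i) lr) k (1≤k , k<i))

isLRmax-false : ∀ v i → isLRmax v i ≡ false → ∃[ k ] 1 ≤ k × k < i × v i ≤ v k
isLRmax-false v (suc i) ¬lr
  with allB-interval-false (λ j → v j <ᵇ v (suc i)) 1 i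
         (subst (λ xs → allB (λ j → v j <ᵇ v (suc i)) xs ≡ false) (range-interval i) ¬lr)
... | k , (1≤k , k<i) , vk≮vi = k , 1≤k , k<i , <ᵇ-false⇒≥ vk≮vi

isRLmax-true : ∀ n v i → isRLmax n v i ≡ true → ∀ k → i < k → k ≤ n → v k < v i
isRLmax-true n v i rl k i<k k≤n = <ᵇ-true⇒<
  (allB-interval-true _ (suc i) (n ∸ i)
    (subst (λ xs → allB _ xs ≡ true) (map-+-range i (n ∸ i)) rl) k
    (i<k , s≤s (subst (k ≤_) (sym (m+[n∸m]≡n (<⇒≤ (<-≤-trans i<k k≤n)))) k≤n)))

isRLmax-false : ∀ n v i → i ≤ n → isRLmax n v i ≡ false → ∃[ k ] i < k × k ≤ n × v i ≤ v k
isRLmax-false n v i i≤n ¬rl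
  with allB-interval-false _ (suc i) (n ∸ i)
         (subst (λ xs → allB _ xs ≡ false) (map-+-range i (n ∸ i)) ¬rl)
... | k , (i<k , k<) , vk≮vi =
  k , i<k , subst (k ≤_) (m+[n∸m]≡n i≤n) (≤-pred k<) , <ᵇ-false⇒≥ vk≮vi

lrMax-bounds-gap : ∀ v {t u} → (∀ k → 1 ≤ k → k < t → v k < v t) →
  (∀ j → t < j → j < u → isLRmax v j ≡ false) → ∀ j → t < j → j < u → v j ≤ v t
lrMax-bounds-gap v {t} {u} t-max gap j = go j (<-wellFounded j)
  where
  go : ∀ j → Acc _<_ j → t < j → j < u → v j ≤ v t
  go j (acc rs) t<j j<u with isLRmax-false v j (gap j t<j j<u)
  ... | k , 1≤k , k<j , vj≤vk with <-cmp k t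
  ...   | tri< k<t _ _ = ≤-trans vj≤vk (<⇒≤ (t-max k 1≤k k<t))
  ...   | tri≈ _ refl _ = vj≤vk
  ...   | tri> _ _ t<k = ≤-trans vj≤vk (go k (rs k<j) t<k (<-trans k<j j<u))

rlMax-bounds-gap : ∀ n v {t u} → u ≤ n → (∀ k → u < k → k ≤ n → v k < v u) →
  (∀ j → t < j → j < u → isRLmax n v j ≡ false) → ∀ j → t < j → j < u → v j ≤ v u
rlMax-bounds-gap n v {t} {u} u≤n u-max gap j = go j (<-wellFounded (u ∸ j))
  where
  go : ∀ j → Acc _<_ (u ∸ j) → t < j → j < u → v j ≤ v u
  go j (acc rs) t<j j<u with isRLmax-false n v j (≤-trans (<⇒≤ j<u) u≤n) (gap j t<j j<u)
  ... | k , j<k , k≤n , vj≤vk with <-cmp k u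
  ...   | tri< k<u _ _ = ≤-trans vj≤vk (go k (rs (∸-monoʳ-< j<k (<⇒≤ k<u))) (<-trans t<j j<k) k<u)
  ...   | tri≈ _ refl _ = vj≤vk
  ...   | tri> _ _ u<k = ≤-trans vj≤vk (<⇒≤ (u-max k u<k k≤n))

record LastTwoLRMaxima (n : ℕ) (v : ℕ → ℕ) (a A : ℕ) : Set where
  field
    1≤a : 1 ≤ a
    a<A : a < A
    A≤n : A ≤ n
    a-lrMax : ∀ k → 1 ≤ k → k < a → v k < v a
    A-lrMax : ∀ k → 1 ≤ k → k < A → v k < v A
    gap≤a : ∀ j → a < j → j < A → v j ≤ v a
    suffix≤A : ∀ j → A < j → j ≤ n → v j ≤ v A

record FirstTwoRLMaxima (n : ℕ) (v : ℕ → ℕ) (b₁ b₂ : ℕ) : Set where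
  field
    b₁<b₂ : b₁ < b₂
    b₂≤n : b₂ ≤ n
    prefix-not-rlMax : ∀ j → 1 ≤ j → j < b₁ → isRLmax n v j ≡ false
    gap≤b₂ : ∀ j → b₁ < j → j < b₂ → v j ≤ v b₂

lrMaxPositions-selected : ∀ n v → lrMaxPositions n v ≡ selected (isLRmax v) 1 n
lrMaxPositions-selected n v = cong (filter _) (range-interval n)

rlMaxPositions-selected : ∀ n v → rlMaxPositions n v ≡ selected (isRLmax n v) 1 n
rlMaxPositions-selected n v = cong (filter _) (range-interval n)

lastTwoSelectedLRMaxima : ∀ n v → let L = selected (isLRmax v) 1 n ; h = length L in
  2 ≤ h → LastTwoLRMaxima n v (nth L (h ∸ 1)) (nth L h)
lastTwoSelectedLRMaxima n v 2≤h = record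
  { 1≤a = proj₁ (proj₁ a∈)
  ; a<A = proj₁ gap
  ; A≤n = ≤-pred (proj₂ (proj₁ A∈))
  ; a-lrMax = a-lrMax
  ; A-lrMax = A-lrMax
  ; gap≤a = lrMax-bounds-gap v a-lrMax (proj₂ gap)
  ; suffix≤A = λ j A<j j≤n → lrMax-bounds-gap v A-lrMax
      (λ j A<j j<1+n → selected-last (isLRmax v) 1 n j (≤-<-trans z≤n A<j) A<j j<1+n) j A<j (s≤s j≤n)
  }
  where
  h = length (selected (isLRmax v) 1 n)
  a∈ = selected-member (isLRmax v) 1 n (h ∸ 1) (∸-monoˡ-≤ 1 2≤h) (m∸n≤m h 1)
  A∈ = selected-member (isLRmax v) 1 n h (≤-trans (s≤s z≤n) 2≤h) ≤-refl
  gap = selected-gap (isLRmax v) 1 n h 2≤h ≤-refl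
  a-lrMax = isLRmax-true v _ (proj₂ a∈)
  A-lrMax = isLRmax-true v _ (proj₂ A∈)

lastTwoLRMaxima : ∀ n v → let L = lrMaxPositions n v ; h = length L in
  2 ≤ h → LastTwoLRMaxima n v (nth L (h ∸ 1)) (nth L h)
lastTwoLRMaxima n v rewrite lrMaxPositions-selected n v = lastTwoSelectedLRMaxima n v

firstTwoSelectedRLMaxima : ∀ n v → let R = selected (isRLmax n v) 1 n in
  2 ≤ length R → FirstTwoRLMaxima n v (nth R 1) (nth R 2)
firstTwoSelectedRLMaxima n v 2≤g = record
  { b₁<b₂ = proj₁ gap
  ; b₂≤n = b₂≤n
  ; prefix-not-rlMax = selected-first (isRLmax n v) 1 n
  ; gap≤b₂ = rlMax-bounds-gap n v b₂≤n (isRLmax-true n v _ (proj₂ b₂∈)) (proj₂ gap)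
  }
  where
  b₂∈ = selected-member (isRLmax n v) 1 n 2 (s≤s z≤n) 2≤g
  b₂≤n = ≤-pred (proj₂ (proj₁ b₂∈))
  gap = selected-gap (isRLmax n v) 1 n 2 ≤-refl 2≤g

firstTwoRLMaxima : ∀ n v → let R = rlMaxPositions n v in
  2 ≤ length R → FirstTwoRLMaxima n v (nth R 1) (nth R 2)
firstTwoRLMaxima n v rewrite rlMaxPositions-selected n v = firstTwoSelectedRLMaxima n v

lastDescentBefore-spec : ∀ v a → let x = lastDescentBefore v a in
  x ≡ 0 ⊎ (1 ≤ x × x < a × v (suc x) < v x)
lastDescentBefore-spec v zero = inj₁ refl
lastDescentBefore-spec v (suc a) rewrite range-interval a
  with selected-max (λ j → v (suc j) <ᵇ v j) 1 a
... | inj₁ x≡0 = inj₁ x≡0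
... | inj₂ ((1≤x , x<1+a) , descent) = inj₂ (1≤x , x<1+a , <ᵇ-true⇒< descent)

module _ {m : ℕ} {us : Vec ℕ m} (us↗ : Linked _<_ us) where

  lookup-mono-< : ∀ {i j} → i F.< j → lookup us i < lookup us j
  lookup-mono-< = lookup⁺ <-trans us↗

  lookup-mono-≤ : ∀ {i j} → i F.≤ j → lookup us i ≤ lookup us j
  lookup-mono-≤ {i} {j} i≤j with m≤n⇒m<n∨m≡n i≤j
  ... | inj₁ i<j = <⇒≤ (lookup-mono-< i<j)
  ... | inj₂ i≡j rewrite toℕ-injective i≡j = ≤-refl

  lookup-reflects-< : ∀ {i j} → lookup us i < lookup us j → i F.< j
  lookup-reflects-< {i} {j} lt with Finₚ.<-cmp i j
  ... | tri< i<j _ _ = i<j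
  ... | tri≈ _ refl _ = ⊥-elim (<-irrefl refl lt)
  ... | tri> _ _ j<i = ⊥-elim (<-asym lt (lookup-mono-< j<i))

-- ρ gives the 0-based rank of each letter of the pattern; us lists the values of the occurrence
-- in increasing order.
occurrence-of-ranks : ∀ {m n} {v : ℕ → ℕ} (ρ : Vec (Fin (suc m)) (suc m)) (ps us : Vec ℕ (suc m)) →
  Linked _<_ ps → 1 ≤ lookup ps F.zero → lookup ps (F.fromℕ m) ≤ n →
  Linked _<_ us → mapᵛ v ps ≡ mapᵛ (lookup us) ρ →
  Occurrence (mapᵛ (suc ∘ F.toℕ) ρ) n v
occurrence-of-ranks {n = n} {v} ρ ps us ps↗ 1≤first last≤n us↗ v∘ps≡us∘ρ =
  lookup ps , (λ _ _ → lookup-mono-< ps↗) , in-range , order-isomorphic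
  where
  in-range : ∀ p → 1 ≤ lookup ps p × lookup ps p ≤ n
  in-range p = ≤-trans 1≤first (lookup-mono-≤ ps↗ z≤n) , ≤-trans (lookup-mono-≤ ps↗ (≤fromℕ p)) last≤n

  value-by-rank : ∀ p → v (lookup ps p) ≡ lookup us (lookup ρ p)
  value-by-rank p = begin
    v (lookup ps p)              ≡⟨ lookup-map p v ps ⟨
    lookup (mapᵛ v ps) p         ≡⟨ cong (λ ws → lookup ws p) v∘ps≡us∘ρ ⟩
    lookup (mapᵛ (lookup us) ρ) p ≡⟨ lookup-map p (lookup us) ρ ⟩
    lookup us (lookup ρ p)       ∎
    where open ≡-Reasoning

  order-isomorphic : ∀ p q → (v (lookup ps p) < v (lookup ps q)) ⇔
    (lookup (mapᵛ (suc ∘ F.toℕ) ρ) p < lookup (mapᵛ (suc ∘ F.toℕ) ρ) q)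
  order-isomorphic p q
    rewrite value-by-rank p | value-by-rank q
          | lookup-map p (suc ∘ F.toℕ) ρ | lookup-map q (suc ∘ F.toℕ) ρ =
    mk⇔ (s<s ∘ lookup-reflects-< us↗) (lookup-mono-< us↗ ∘ s<s⁻¹)

module _ {n : ℕ} {v : ℕ → ℕ}
  (injective : ∀ i j → 1 ≤ i → i ≤ n → 1 ≤ j → j ≤ n → v i ≡ v j → i ≡ j)
  (avoids-31425 : Avoids p31425 n v) (avoids-32415 : Avoids p32415 n v)
  (avoids-31524 : Avoids p31524 n v) (avoids-32514 : Avoids p32514 n v)
  where

  distinct : ∀ {i j} → 1 ≤ i → i < j → j ≤ n → v i ≢ v j
  distinct 1≤i i<j j≤n = <⇒≢ i<j ∘
    injective _ _ 1≤i (<⇒≤ (<-≤-trans i<j j≤n)) (≤-<-trans z≤n i<j) j≤n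

  comparable : ∀ {i j} → 1 ≤ i → i < j → j ≤ n → v i < v j ⊎ v j < v i
  comparable {i} {j} 1≤i i<j j≤n with <-cmp (v i) (v j)
  ... | tri< lt _ _ = inj₁ lt
  ... | tri≈ _ eq _ = ⊥-elim (distinct 1≤i i<j j≤n eq)
  ... | tri> _ _ gt = inj₂ gt

  -- The four avoided patterns are exactly the orders of five letters in which the second and fourth
  -- lie below the first and the third and fifth lie above it.
  fourth-above-first : ∀ {i₁ i₂ i₃ i₄ i₅} → 1 ≤ i₁ → i₁ < i₂ → i₂ < i₃ → i₃ < i₄ → i₄ < i₅ → i₅ ≤ n →
    v i₂ < v i₁ → v i₁ < v i₃ → v i₁ < v i₅ → v i₁ < v i₄
  fourth-above-first {i₁} {i₂} {i₃} {i₄} {i₅} 1≤i₁ i₁<i₂ i₂<i₃ i₃<i₄ i₄<i₅ i₅≤n v₂<v₁ v₁<v₃ v₁<v₅ =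
    above (comparable 1≤i₁ (<-trans i₁<i₂ i₂<i₄) i₄≤n)
    where
    i₂<i₄ = <-trans i₂<i₃ i₃<i₄
    i₄≤n = <⇒≤ (<-≤-trans i₄<i₅ i₅≤n)

    occurs : ∀ ρ us → Linked _<_ us → mapᵛ v (i₁ ∷ i₂ ∷ i₃ ∷ i₄ ∷ i₅ ∷ []) ≡ mapᵛ (lookup us) ρ →
      Occurrence (mapᵛ (suc ∘ F.toℕ) ρ) n v
    occurs ρ us = occurrence-of-ranks ρ _ us (i₁<i₂ ∷ i₂<i₃ ∷ i₃<i₄ ∷ i₄<i₅ ∷ [-]) 1≤i₁ i₅≤n

    forbidden : v i₄ < v i₁ → v i₂ < v i₄ ⊎ v i₄ < v i₂ → v i₃ < v i₅ ⊎ v i₅ < v i₃ → ⊥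
    forbidden v₄<v₁ (inj₁ v₂<v₄) (inj₁ v₃<v₅) = avoids-31425
      (occurs (# 2 ∷ # 0 ∷ # 3 ∷ # 1 ∷ # 4 ∷ []) _ (v₂<v₄ ∷ v₄<v₁ ∷ v₁<v₃ ∷ v₃<v₅ ∷ [-]) refl)
    forbidden v₄<v₁ (inj₂ v₄<v₂) (inj₁ v₃<v₅) = avoids-32415
      (occurs (# 2 ∷ # 1 ∷ # 3 ∷ # 0 ∷ # 4 ∷ []) _ (v₄<v₂ ∷ v₂<v₁ ∷ v₁<v₃ ∷ v₃<v₅ ∷ [-]) refl)
    forbidden v₄<v₁ (inj₁ v₂<v₄) (inj₂ v₅<v₃) = avoids-31524
      (occurs (# 2 ∷ # 0 ∷ # 4 ∷ # 1 ∷ # 3 ∷ []) _ (v₂<v₄ ∷ v₄<v₁ ∷ v₁<v₅ ∷ v₅<v₃ ∷ [-]) refl)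
    forbidden v₄<v₁ (inj₂ v₄<v₂) (inj₂ v₅<v₃) = avoids-32514
      (occurs (# 2 ∷ # 1 ∷ # 4 ∷ # 0 ∷ # 3 ∷ []) _ (v₄<v₂ ∷ v₂<v₁ ∷ v₁<v₅ ∷ v₅<v₃ ∷ [-]) refl)

    above : v i₁ < v i₄ ⊎ v i₄ < v i₁ → v i₁ < v i₄
    above (inj₁ v₁<v₄) = v₁<v₄
    above (inj₂ v₄<v₁) = ⊥-elim (forbidden v₄<v₁
      (comparable (≤-<-trans z≤n i₁<i₂) i₂<i₄ i₄≤n)
      (comparable (≤-<-trans z≤n (<-trans i₁<i₂ i₂<i₃)) (<-trans i₃<i₄ i₄<i₅) i₅≤n))

  module _ {a A b₁ b₂ : ℕ} (LR : LastTwoLRMaxima n v a A) (RL : FirstTwoRLMaxima n v b₁ b₂) where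
    open LastTwoLRMaxima LR
    open FirstTwoRLMaxima RL

    1≤A : 1 ≤ A
    1≤A = ≤-trans 1≤a (<⇒≤ a<A)

    b₁≤A : b₁ ≤ A
    b₁≤A = ≮⇒≥ λ A<b₁ → A-rlMax (isRLmax-false n v A A≤n (prefix-not-rlMax A 1≤A A<b₁))
      where
      A-rlMax : ¬ (∃[ k ] A < k × k ≤ n × v A ≤ v k)
      A-rlMax (k , A<k , k≤n , vA≤vk) = distinct 1≤A A<k k≤n (≤-antisym vA≤vk (suffix≤A k A<k k≤n))

    descent-ends-before : ∀ {x} → 1 ≤ x → x < a → v (suc x) < v x → suc x < a
    descent-ends-before {x} 1≤x x<a descent with m≤n⇒m<n∨m≡n x<a
    ... | inj₁ 1+x<a = 1+x<a
    ... | inj₂ refl = ⊥-elim (<-asym descent (a-lrMax x 1≤x ≤-refl))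

    gap-above-descent : ∀ {x} → 1 ≤ x → x < a → v (suc x) < v x →
      ∀ j → a < j → j < A → v x < v j × v j < v a
    gap-above-descent {x} 1≤x x<a descent j a<j j<A =
      fourth-above-first 1≤x ≤-refl (descent-ends-before 1≤x x<a descent) a<j j<A A≤n descent
        (a-lrMax x 1≤x x<a) (A-lrMax x 1≤x (<-trans x<a a<A)) ,
      ≤∧≢⇒< (gap≤a j a<j j<A) (≢-sym (distinct 1≤a a<j (<⇒≤ (<-≤-trans j<A A≤n))))

    tail-above-descent : ∀ {x} → 1 ≤ x → x < a → v (suc x) < v x →
      v x < v b₂ → ∀ j → A < j → j < b₂ → v x < v j × v j < v b₂
    tail-above-descent {x} 1≤x x<a descent vx<vb₂ j A<j j<b₂ =
      fourth-above-first 1≤x ≤-refl (<-trans (descent-ends-before 1≤x x<a descent) a<A) A<j j<b₂ b₂≤n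
        descent (A-lrMax x 1≤x (<-trans x<a a<A)) vx<vb₂ ,
      ≤∧≢⇒< (gap≤b₂ j (≤-<-trans b₁≤A A<j) j<b₂) (distinct (≤-<-trans z≤n A<j) j<b₂ b₂≤n)

    classify-last-descent : ∀ {x} → x ≡ 0 ⊎ (1 ≤ x × x < a × v (suc x) < v x) →
      let tail = v x < v b₂ → ∀ j → A < j → j < b₂ → v x < v j × v j < v b₂ in
      (x ≡ 0)
      ⊎ (x ≢ 0 × A ≡ a + 1 × tail)
      ⊎ (x ≢ 0 × a + 1 < A × (∀ j → a < j → j < A → v x < v j × v j < v a) × tail)
    classify-last-descent (inj₁ x≡0) = inj₁ x≡0
    classify-last-descent (inj₂ (1≤x , x<a , descent)) with m≤n⇒m<n∨m≡n a<A
    ... | inj₂ 1+a≡A = inj₂ (inj₁ (m<n⇒n≢0 1≤x , trans (sym 1+a≡A) (+-comm 1 a) ,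
            tail-above-descent 1≤x x<a descent))
    ... | inj₁ 1+a<A = inj₂ (inj₂ (m<n⇒n≢0 1≤x , subst (_< A) (+-comm 1 a) 1+a<A ,
            gap-above-descent 1≤x x<a descent , tail-above-descent 1≤x x<a descent))

lemma3p11 : (n : ℕ) (v : ℕ → ℕ) → DistinctPositive n v →
    Avoids p31425 n v → Avoids p32415 n v → Avoids p31524 n v → Avoids p32514 n v →
    let h = length (lrMaxPositions n v)
        g = length (rlMaxPositions n v)
        ah = nth (lrMaxPositions n v) h
        ah1 = nth (lrMaxPositions n v) (h ∸ 1)
        b2 = nth (rlMaxPositions n v) 2
        x = lastDescentBefore v ah1
        tail23 = v x < v b2 → ∀ j → ah < j → j < b2 → v x < v j × v j < v b2
    in 1 < g → h < ah → 2 < h → v b2 < v ah1 →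
    (x ≡ 0)
    ⊎ (x ≢ 0 × ah ≡ ah1 + 1 × tail23)
    ⊎ (x ≢ 0 × ah1 + 1 < ah × (∀ j → ah1 < j → j < ah → v x < v j × v j < v ah1) × tail23)
lemma3p11 n v (_ , injective) av₁ av₂ av₃ av₄ 1<g _ 2<h _ =
  classify-last-descent injective av₁ av₂ av₃ av₄
    (lastTwoLRMaxima n v (<⇒≤ 2<h)) (firstTwoRLMaxima n v 1<g) (lastDescentBefore-spec v _)
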